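{- For every fixed $\varepsilon>0$ and fixed integer $d\geq3$ there exists a constant $C=C(\varepsilon,d)$ such that the following holds. If $V$ is a fixed set of $n$ vertices and $E_0\subseteq\binom{V}{2}$ is a set of $m\leq(1-\varepsilon)\frac{nd}{2}$ pairs of vertices, and $G$ is the uniformly random $d$-regular graph on $V$, then $$\Pr[E_0\subseteq E(G)]\leq\left(\frac{Cd}{n}\right)^m.$$
   Context: Throughout, $n$ is assumed sufficiently large and $dn$ even. -}

module Defs where

open import Data.Bool using (Bool; true; false; _∧_; not; if_then_else_)
open import Data.Nat using (ℕ; zero; suc; _<ᵇ_; _≡ᵇ_)
open import Data.Fin using (Fin; toℕ)
open import Data.Vec using (Vec; []; _∷_; lookup)
open import Data.List using (List; []; _∷_; length; filterᵇ; concatMap; map; allFin)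

allᵇ : {A : Set} → (A → Bool) → List A → Bool
allᵇ p []       = true
allᵇ p (x ∷ xs) = p x ∧ allᵇ p xs

allVecs : {A : Set} → (k : ℕ) → List A → List (Vec A k)
allVecs zero    xs = [] ∷ []
allVecs (suc k) xs = concatMap (λ x → map (x ∷_) (allVecs k xs)) xs

Adj : ℕ → Set
Adj n = Vec (Vec Bool n) n

adj : {n : ℕ} → Adj n → Fin n → Fin n → Bool
adj A i j = lookup (lookup A i) j

allAdj : (n : ℕ) → List (Adj n)
allAdj n = allVecs n (allVecs n (true ∷ false ∷ []))

_==_ : Bool → Bool → Bool
true  == b = b
false == b = not b

isSimpleGraph : {n : ℕ} → Adj n → Bool
isSimpleGraph {n} A =
  allᵇ (λ i → not (adj A i i) ∧ allᵇ (λ j → adj A i j == adj A j i) (allFin n)) (allFin n)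

degree : {n : ℕ} → Adj n → Fin n → ℕ
degree {n} A v = length (filterᵇ (λ j → adj A v j) (allFin n))

isRegular : {n : ℕ} → ℕ → Adj n → Bool
isRegular {n} d A = isSimpleGraph A ∧ allᵇ (λ v → degree A v ≡ᵇ d) (allFin n)

edgeCount : {n : ℕ} → Adj n → ℕ
edgeCount {n} A =
  length (concatMap (λ i → filterᵇ (λ j → (toℕ i <ᵇ toℕ j) ∧ adj A i j) (allFin n)) (allFin n))

subgraphᵇ : {n : ℕ} → Adj n → Adj n → Bool
subgraphᵇ {n} E G =
  allᵇ (λ i → allᵇ (λ j → if adj E i j then adj G i j else true) (allFin n)) (allFin n)

-- Number of d-regular graphs on Fin n (the sample space of the uniform random d-regular graph).
numRegular : ℕ → ℕ → ℕ
numRegular n d = length (filterᵇ (isRegular d) (allAdj n))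

numRegularContaining : (n d : ℕ) → Adj n → ℕ
numRegularContaining n d E₀ =
  length (filterᵇ (λ G → isRegular d G ∧ subgraphᵇ E₀ G) (allAdj n))

-- Delete an edge uv of E₀ to get E.  A switching maps regular graphs G ⊇ E₀ to
-- regular graphs G′ ⊇ E: for an ordered edge xy of G outside E, with x ≠ u, y ≠ v
-- and ux, vy ∉ G, replace uv, xy by ux, vy.  Each G admits at least
-- nd − 2|E| − 2d − 2d² such pairs (x, y), and each G′ is hit by at most d² of
-- them, since x, y must be neighbours of u, v in G′; for fixed (x, y) the switching
-- is G ↦ G ⊕ C with C the 4-cycle u v y x, an involution, hence injective.  When
-- 2|E₀| ≤ (1 − p/q) nd and n ≥ 4q(1 + d) this yields #(G ⊇ E₀) · n ≤ 2qd · #(G′ ⊇ E),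
-- and induction on the number of edges gives the bound with C = 2q.

module Submission where

open import Defs
open import Data.Bool using (Bool; true; false; T; _∧_; _∨_; not; _xor_; if_then_else_)
open import Data.Bool.Properties using (∨-zeroʳ; xor-identityʳ; ∧-comm; ∨-comm; T-≡; ∧-zeroʳ; ∧-identityʳ; ∧-conicalˡ; ∧-conicalʳ; ∨-conicalˡ; ∨-conicalʳ)
open import Data.Empty using (⊥; ⊥-elim)
open import Data.Fin using (Fin; zero; suc; toℕ)
open import Data.Fin.Properties using (_≟_; toℕ-injective)
open import Data.List.Properties using (length-++)
open import Data.List using (List; []; _∷_; length; filterᵇ; concatMap; map; allFin; _++_)
import Data.List as List
open import Data.Nat using (ℕ; zero; suc; _<ᵇ_; _+_; _*_; _^_; _≤_; _<_; _≥_; z≤n; s≤s; NonZero; >-nonZero)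
open import Data.Nat.Divisibility using (_∣_)
open import Data.Nat.Properties hiding (_≟_)
open import Data.Nat.Tactic.RingSolver using (solve-∀)
open import Algebra.Properties.CommutativeSemigroup +-commutativeSemigroup using () renaming (interchange to +-interchange)
open import Algebra.Properties.Semiring.Sum +-*-semiring
  using (sum; sum-syntax; sum-cong-≗; sum-replicate-zero; ∑-distrib-+; ∑-comm; *-distribˡ-sum; *-distribʳ-sum)
open import Data.Product using (∃-syntax; _×_; _,_; proj₁; proj₂)
open import Data.Sum using (_⊎_; inj₁; inj₂)
open import Data.Vec using (Vec; []; _∷_; lookup; zipWith; tabulate)
open import Data.Vec.Properties using (lookup-zipWith; lookup∘tabulate)
open import Function using (_∘_; id; case_of_; Equivalence)
open import Relation.Binary.Definitions using (tri<; tri≈; tri>)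
open import Relation.Binary.PropositionalEquality
open import Relation.Nullary using (¬_; does; yes; no)
open import Relation.Nullary.Decidable using (dec-true)

private variable
  A B : Set
  n : ℕ

-- Indicator sums

𝟙 : Bool → ℕ
𝟙 true  = 1
𝟙 false = 0

𝟙-∧ : ∀ a b → 𝟙 (a ∧ b) ≡ 𝟙 a * 𝟙 b
𝟙-∧ true  b = sym (+-identityʳ (𝟙 b))
𝟙-∧ false b = refl

𝟙-mono : ∀ {a b} → (a ≡ true → b ≡ true) → 𝟙 a ≤ 𝟙 b
𝟙-mono {false} _   = z≤n
𝟙-mono {true}  a⇒b rewrite a⇒b refl = ≤-refl

𝟙-∨-disjoint : ∀ a b → (a ≡ true → b ≡ true → ⊥) → 𝟙 (a ∨ b) ≡ 𝟙 a + 𝟙 b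
𝟙-∨-disjoint true  true  a∧b = ⊥-elim (a∧b refl refl)
𝟙-∨-disjoint true  false _   = refl
𝟙-∨-disjoint false b     _   = refl

𝟙-positive : ∀ {a} → 0 < 𝟙 a → a ≡ true
𝟙-positive {true} _ = refl

∨-sound : ∀ {a b} → (a ∨ b) ≡ true → a ≡ true ⊎ b ≡ true
∨-sound {true}  _ = inj₁ refl
∨-sound {false} b = inj₂ b

𝟙-xor : ∀ a m → 𝟙 (a xor m) + 𝟙 (m ∧ a) ≡ 𝟙 a + 𝟙 (m ∧ not a)
𝟙-xor true  true  = refl
𝟙-xor true  false = refl
𝟙-xor false true  = refl
𝟙-xor false false = refl

𝟙-xor-⊆ : ∀ a l → (l ≡ true → a ≡ true) → 𝟙 a ≡ 𝟙 (a xor l) + 𝟙 l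
𝟙-xor-⊆ a     false _   = trans (cong 𝟙 (sym (xor-identityʳ a))) (sym (+-identityʳ _))
𝟙-xor-⊆ true  true  _   = refl
𝟙-xor-⊆ false true  l⇒a = case l⇒a refl of λ ()

∨-∧-split : ∀ a b g → (a ≡ true → g ≡ true) → (b ≡ true → g ≡ false) → ((a ∨ b) ∧ g ≡ a) × ((a ∨ b) ∧ not g ≡ b)
∨-∧-split true  _     false a⇒g _   = case a⇒g refl of λ ()
∨-∧-split true  true  true  _   b⇒¬g = case b⇒¬g refl of λ ()
∨-∧-split true  false true  _   _   = refl , refl
∨-∧-split false true  true  _   b⇒¬g = case b⇒¬g refl of λ ()
∨-∧-split false false true  _   _   = refl , refl
∨-∧-split false b     false _   _   = ∧-zeroʳ b , ∧-identityʳ b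

𝟙-∧-≤ : ∀ {g c} a b → (g ≡ true → c ≡ true → (a ∧ b) ≡ true) → 𝟙 (g ∧ c) ≤ 𝟙 a * 𝟙 b
𝟙-∧-≤ {false}        a b _ = z≤n
𝟙-∧-≤ {true} {false} a b _ = z≤n
𝟙-∧-≤ {true} {true}  a b h rewrite sym (𝟙-∧ a b) | h refl refl = ≤-refl

𝟙-∧-∨-≤ : ∀ g c c′ → 𝟙 (g ∧ (c ∨ c′)) ≤ 𝟙 (g ∧ c) + 𝟙 (g ∧ c′)
𝟙-∧-∨-≤ false _     _  = z≤n
𝟙-∧-∨-≤ true  true  _  = s≤s z≤n
𝟙-∧-∨-≤ true  false c′ = ≤-refl

𝟙-split : ∀ g c → 𝟙 g ≡ 𝟙 (g ∧ not c) + 𝟙 (g ∧ c)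
𝟙-split false _     = refl
𝟙-split true  true  = refl
𝟙-split true  false = refl

double-injective : ∀ {x y} → x + x ≡ y + y → x ≡ y
double-injective {x} {y} eq = *-cancelˡ-≡ x y 2 (trans (cong (x +_) (+-identityʳ x)) (trans eq (cong (y +_) (sym (+-identityʳ y)))))

sum-mono : ∀ {n} {f g : Fin n → ℕ} → (∀ i → f i ≤ g i) → sum f ≤ sum g
sum-mono {zero}  _   = z≤n
sum-mono {suc n} f≤g = +-mono-≤ (f≤g zero) (sum-mono (f≤g ∘ suc))

sum-const : ∀ n c → ∑[ i < n ] c ≡ n * c
sum-const zero    c = refl
sum-const (suc n) c = cong (c +_) (sum-const n c)

sum-positive : ∀ {n} (f : Fin n → ℕ) → 0 < sum f → ∃[ i ] 0 < f i
sum-positive {suc n} f pos with f zero in eq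
... | suc _ = zero , subst (0 <_) (sym eq) (s≤s z≤n)
... | zero with i , fi>0 ← sum-positive (f ∘ suc) pos = suc i , fi>0

∑∑ : ∀ {n} → (Fin n → Fin n → ℕ) → ℕ
∑∑ {n} f = ∑[ x < n ] ∑[ y < n ] f x y

∑∑-cong : ∀ {n} {f g : Fin n → Fin n → ℕ} → (∀ x y → f x y ≡ g x y) → ∑∑ f ≡ ∑∑ g
∑∑-cong f≡g = sum-cong-≗ (λ x → sum-cong-≗ (f≡g x))

∑∑-mono : ∀ {n} {f g : Fin n → Fin n → ℕ} → (∀ x y → f x y ≤ g x y) → ∑∑ f ≤ ∑∑ g
∑∑-mono f≤g = sum-mono (λ x → sum-mono (f≤g x))

∑∑-distrib-+ : ∀ {n} (f g : Fin n → Fin n → ℕ) → ∑∑ (λ x y → f x y + g x y) ≡ ∑∑ f + ∑∑ g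
∑∑-distrib-+ {n} f g = trans (sum-cong-≗ (λ x → ∑-distrib-+ (f x) (g x))) (∑-distrib-+ (λ x → ∑[ y < n ] f x y) _)

∑∑-zero : ∀ n → ∑∑ {n} (λ _ _ → 0) ≡ 0
∑∑-zero n = trans (sum-cong-≗ {n} (λ _ → sum-replicate-zero n)) (sum-replicate-zero n)

∑∑-product : ∀ {n} (f g : Fin n → ℕ) → ∑∑ (λ x y → f x * g y) ≡ sum f * sum g
∑∑-product f g = trans (sum-cong-≗ (λ x → sym (*-distribˡ-sum (f x) g))) (sym (*-distribʳ-sum _ f))

∑∑-+-≤ : {f g : Fin n → Fin n → ℕ} {a b : ℕ} → ∑∑ f ≤ a → ∑∑ g ≤ b → ∑∑ (λ x y → f x y + g x y) ≤ a + b
∑∑-+-≤ {f = f} {g} f≤a g≤b = ≤-trans (≤-reflexive (∑∑-distrib-+ f g)) (+-mono-≤ f≤a g≤b)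

∑∑-*ˡ : ∀ c (f : Fin n → Fin n → ℕ) → c * ∑∑ f ≡ ∑∑ (λ x y → c * f x y)
∑∑-*ˡ {n} c f = trans (*-distribˡ-sum c (λ x → ∑[ y < n ] f x y)) (sum-cong-≗ {n} (λ x → *-distribˡ-sum c (f x)))

sum-𝟙-∨ : (p q : Fin n → Bool) → (∀ j → p j ≡ true → q j ≡ true → ⊥) →
  ∑[ j < n ] 𝟙 (p j ∨ q j) ≡ ∑[ j < n ] 𝟙 (p j) + ∑[ j < n ] 𝟙 (q j)
sum-𝟙-∨ {n} p q disjoint = trans (sum-cong-≗ {n} (λ j → 𝟙-∨-disjoint (p j) (q j) (disjoint j))) (∑-distrib-+ (𝟙 ∘ p) (𝟙 ∘ q))

_=ᵇ_ : ∀ {n} → Fin n → Fin n → Bool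
i =ᵇ j = does (i ≟ j)

=ᵇ⇒≡ : ∀ {n} {i j : Fin n} → (i =ᵇ j) ≡ true → i ≡ j
=ᵇ⇒≡ {i = i} {j} eq with i ≟ j
... | yes i≡j = i≡j

=ᵇ-refl : ∀ {n} (i : Fin n) → (i =ᵇ i) ≡ true
=ᵇ-refl i = dec-true (i ≟ i) refl

=ᵇ-false⇒≢ : ∀ {n} {i j : Fin n} → (i =ᵇ j) ≡ false → i ≢ j
=ᵇ-false⇒≢ {i = i} i≠j refl = case trans (sym (=ᵇ-refl i)) i≠j of λ ()

sum-𝟙-=ᵇ : ∀ {n} (b : Fin n) → ∑[ j < n ] 𝟙 (j =ᵇ b) ≡ 1
sum-𝟙-=ᵇ {suc n} zero    = cong suc (sum-replicate-zero n)
sum-𝟙-=ᵇ {suc n} (suc b) = sum-𝟙-=ᵇ b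

sumOver : List A → (A → ℕ) → ℕ
sumOver []       f = 0
sumOver (x ∷ xs) f = f x + sumOver xs f

sumOver-cong : (xs : List A) {f g : A → ℕ} → (∀ x → f x ≡ g x) → sumOver xs f ≡ sumOver xs g
sumOver-cong []       f≡g = refl
sumOver-cong (x ∷ xs) f≡g = cong₂ _+_ (f≡g x) (sumOver-cong xs f≡g)

sumOver-mono : (xs : List A) {f g : A → ℕ} → (∀ x → f x ≤ g x) → sumOver xs f ≤ sumOver xs g
sumOver-mono []       f≤g = z≤n
sumOver-mono (x ∷ xs) f≤g = +-mono-≤ (f≤g x) (sumOver-mono xs f≤g)

sumOver-distrib-+ : (xs : List A) (f g : A → ℕ) → sumOver xs (λ x → f x + g x) ≡ sumOver xs f + sumOver xs g
sumOver-distrib-+ []       f g = refl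
sumOver-distrib-+ (x ∷ xs) f g rewrite sumOver-distrib-+ xs f g = +-interchange (f x) (g x) _ _

sumOver-*ʳ : (xs : List A) (c : ℕ) (f : A → ℕ) → sumOver xs (λ x → f x * c) ≡ sumOver xs f * c
sumOver-*ʳ []       c f = refl
sumOver-*ʳ (x ∷ xs) c f = trans (cong (f x * c +_) (sumOver-*ʳ xs c f)) (sym (*-distribʳ-+ c (f x) _))

sumOver-++ : (xs ys : List A) (f : A → ℕ) → sumOver (xs ++ ys) f ≡ sumOver xs f + sumOver ys f
sumOver-++ []       ys f = refl
sumOver-++ (x ∷ xs) ys f = trans (cong (f x +_) (sumOver-++ xs ys f)) (sym (+-assoc (f x) _ _))

sumOver-concatMap : (g : A → List B) (xs : List A) (f : B → ℕ) →
  sumOver (concatMap g xs) f ≡ sumOver xs (λ x → sumOver (g x) f)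
sumOver-concatMap g []       f = refl
sumOver-concatMap g (x ∷ xs) f = trans (sumOver-++ (g x) _ f) (cong (sumOver (g x) f +_) (sumOver-concatMap g xs f))

sumOver-map : (g : A → B) (xs : List A) (f : B → ℕ) → sumOver (map g xs) f ≡ sumOver xs (f ∘ g)
sumOver-map g []       f = refl
sumOver-map g (x ∷ xs) f = cong (f (g x) +_) (sumOver-map g xs f)

sumOver-∑-comm : (xs : List A) {n : ℕ} (f : A → Fin n → ℕ) →
  sumOver xs (λ a → ∑[ i < n ] f a i) ≡ ∑[ i < n ] sumOver xs (λ a → f a i)
sumOver-∑-comm []       {n} f = sym (sum-replicate-zero n)
sumOver-∑-comm (x ∷ xs)     f = trans (cong (sum (f x) +_) (sumOver-∑-comm xs f)) (sym (∑-distrib-+ (f x) _))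

sumOver-∑∑-comm : (xs : List A) {n : ℕ} (f : A → Fin n → Fin n → ℕ) →
  sumOver xs (λ a → ∑∑ (f a)) ≡ ∑∑ (λ x y → sumOver xs (λ a → f a x y))
sumOver-∑∑-comm xs f =
  trans (sumOver-∑-comm xs (λ a x → sum (f a x))) (sum-cong-≗ (λ x → sumOver-∑-comm xs (λ a → f a x)))

length-concatMap : (g : A → List B) (xs : List A) → length (concatMap g xs) ≡ sumOver xs (length ∘ g)
length-concatMap g []       = refl
length-concatMap g (x ∷ xs) = trans (length-++ (g x)) (cong (length (g x) +_) (length-concatMap g xs))

length-filterᵇ : (p : A → Bool) (xs : List A) → length (filterᵇ p xs) ≡ sumOver xs (𝟙 ∘ p)
length-filterᵇ p []       = refl
length-filterᵇ p (x ∷ xs) with p x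
... | true  = cong suc (length-filterᵇ p xs)
... | false = length-filterᵇ p xs

sumOver-allFin : ∀ n (f : Fin n → ℕ) → sumOver (allFin n) f ≡ sum f
sumOver-allFin n f = go n id
  where
  go : ∀ k (h : Fin k → Fin n) → sumOver (List.tabulate h) f ≡ ∑[ i < k ] f (h i)
  go zero    h = refl
  go (suc k) h = cong (f (h zero) +_) (go k (h ∘ suc))

allᵇ-allFin⁻ : ∀ {n} {p : Fin n → Bool} → allᵇ p (allFin n) ≡ true → ∀ i → p i ≡ true
allᵇ-allFin⁻ {n} {p} = go n id
  where
  go : ∀ k (h : Fin k → Fin n) → allᵇ p (List.tabulate h) ≡ true → ∀ i → p (h i) ≡ true
  go (suc k) h all zero    = ∧-conicalˡ _ _ all
  go (suc k) h all (suc i) = go k (h ∘ suc) (∧-conicalʳ _ _ all) i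

allᵇ-allFin⁺ : ∀ {n} {p : Fin n → Bool} → (∀ i → p i ≡ true) → allᵇ p (allFin n) ≡ true
allᵇ-allFin⁺ {n} {p} = go n id
  where
  go : ∀ k (h : Fin k → Fin n) → (∀ i → p (h i) ≡ true) → allᵇ p (List.tabulate h) ≡ true
  go zero    h all = refl
  go (suc k) h all = cong₂ _∧_ (all zero) (go k (h ∘ suc) (all ∘ suc))

not-true : ∀ {a} → not a ≡ true → a ≡ false
not-true {false} _ = refl

==-true : ∀ {a b} → (a == b) ≡ true → a ≡ b
==-true {true}  {true}  _ = refl
==-true {false} {false} _ = refl

==-refl : ∀ a → (a == a) ≡ true
==-refl true  = refl
==-refl false = refl


record IsSimple (A : Adj n) : Set where
  field
    irreflexive : ∀ i → adj A i i ≡ false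
    symmetric   : ∀ i j → adj A i j ≡ adj A j i

open IsSimple

isSimpleGraph-sound : (A : Adj n) → isSimpleGraph A ≡ true → IsSimple A
isSimpleGraph-sound A simple = record
  { irreflexive = λ i → not-true (∧-conicalˡ _ _ (row i))
  ; symmetric   = λ i j → ==-true (allᵇ-allFin⁻ (∧-conicalʳ _ _ (row i)) j)
  }
  where
  row : ∀ i → (not (adj A i i) ∧ allᵇ (λ j → adj A i j == adj A j i) (allFin _)) ≡ true
  row = allᵇ-allFin⁻ simple

isSimpleGraph-complete : (A : Adj n) → IsSimple A → isSimpleGraph A ≡ true
isSimpleGraph-complete A simple = allᵇ-allFin⁺ λ i →
  cong₂ _∧_ (cong not (irreflexive simple i))
            (allᵇ-allFin⁺ λ j → subst (λ b → (adj A i j == b) ≡ true) (symmetric simple i j) (==-refl (adj A i j)))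

deg : Adj n → Fin n → ℕ
deg {n} A v = ∑[ j < n ] 𝟙 (adj A v j)

degree≡deg : (A : Adj n) (v : Fin n) → degree A v ≡ deg A v
degree≡deg {n} A v = trans (length-filterᵇ (adj A v) (allFin n)) (sumOver-allFin n _)

record IsRegular (d : ℕ) (A : Adj n) : Set where
  field
    simple  : IsSimple A
    deg≡    : ∀ v → deg A v ≡ d

open IsRegular

isRegular-sound : (d : ℕ) (A : Adj n) → isRegular d A ≡ true → IsRegular d A
isRegular-sound d A regular = record
  { simple = isSimpleGraph-sound A (∧-conicalˡ _ _ regular)
  ; deg≡   = λ v → trans (sym (degree≡deg A v)) (≡ᵇ⇒≡ _ _ (Equivalence.from T-≡ (allᵇ-allFin⁻ (∧-conicalʳ _ _ regular) v)))
  }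

isRegular-complete : (d : ℕ) (A : Adj n) → IsRegular d A → isRegular d A ≡ true
isRegular-complete d A regular = cong₂ _∧_ (isSimpleGraph-complete A (simple regular))
  (allᵇ-allFin⁺ λ v → Equivalence.to T-≡ (≡⇒≡ᵇ _ _ (trans (degree≡deg A v) (deg≡ regular v))))

_⊆ᴳ_ : Adj n → Adj n → Set
E ⊆ᴳ G = ∀ i j → adj E i j ≡ true → adj G i j ≡ true

subgraphᵇ-sound : (E G : Adj n) → subgraphᵇ E G ≡ true → E ⊆ᴳ G
subgraphᵇ-sound E G sub i j Eij = subst (λ a → (if a then adj G i j else true) ≡ true) Eij (allᵇ-allFin⁻ (allᵇ-allFin⁻ sub i) j)

subgraphᵇ-complete : (E G : Adj n) → E ⊆ᴳ G → subgraphᵇ E G ≡ true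
subgraphᵇ-complete E G sub = allᵇ-allFin⁺ λ i → allᵇ-allFin⁺ λ j → ifᵇ (adj E i j) (sub i j)
  where
  ifᵇ : ∀ a {b} → (a ≡ true → b ≡ true) → (if a then b else true) ≡ true
  ifᵇ true  a⇒b = a⇒b refl
  ifᵇ false _   = refl

regularContaining : ℕ → Adj n → Adj n → Bool
regularContaining d E G = isRegular d G ∧ subgraphᵇ E G

#regularContaining : ℕ → Adj n → ℕ
#regularContaining {n} d E = sumOver (allAdj n) (𝟙 ∘ regularContaining d E)

numRegularContaining≡ : ∀ n d (E : Adj n) → numRegularContaining n d E ≡ #regularContaining d E
numRegularContaining≡ n d E = length-filterᵇ (regularContaining d E) (allAdj n)

regularContaining-sound : ∀ {d} {E G : Adj n} → regularContaining d E G ≡ true → IsRegular d G × E ⊆ᴳ G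
regularContaining-sound {d = d} {E} {G} contains =
  isRegular-sound d G (∧-conicalˡ _ _ contains) , subgraphᵇ-sound E G (∧-conicalʳ _ _ contains)

regularContaining-complete : ∀ {d} {E G : Adj n} → IsRegular d G → E ⊆ᴳ G → regularContaining d E G ≡ true
regularContaining-complete {d = d} {E} {G} regular E⊆G =
  cong₂ _∧_ (isRegular-complete d G regular) (subgraphᵇ-complete E G E⊆G)

#regularContaining≤numRegular : ∀ d (E : Adj n) → #regularContaining d E ≤ numRegular n d
#regularContaining≤numRegular {n} d E = begin
  sumOver (allAdj n) (𝟙 ∘ regularContaining d E)
    ≤⟨ sumOver-mono (allAdj n) (λ G → 𝟙-mono (∧-conicalˡ (isRegular d G) (subgraphᵇ E G))) ⟩
  sumOver (allAdj n) (𝟙 ∘ isRegular d)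
    ≡⟨ length-filterᵇ (isRegular d) (allAdj n) ⟨
  numRegular n d ∎
  where open ≤-Reasoning

-- Toggling adjacency entries

_⊕_ : Adj n → Adj n → Adj n
A ⊕ M = zipWith (zipWith _xor_) A M

adj-⊕ : (A M : Adj n) (i j : Fin n) → adj (A ⊕ M) i j ≡ adj A i j xor adj M i j
adj-⊕ A M i j rewrite lookup-zipWith (zipWith _xor_) i A M = lookup-zipWith _xor_ j (lookup A i) (lookup M i)

fromFun : (Fin n → Fin n → Bool) → Adj n
fromFun f = tabulate (tabulate ∘ f)

adj-fromFun : (f : Fin n → Fin n → Bool) (i j : Fin n) → adj (fromFun f) i j ≡ f i j
adj-fromFun f i j rewrite lookup∘tabulate (tabulate ∘ f) i = lookup∘tabulate (f i) j

sumOver-allVecs-zipWith : {_∙_ : A → B → A} (xs : List A) →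
  (∀ b (g : A → ℕ) → sumOver xs (λ a → g (a ∙ b)) ≡ sumOver xs g) →
  ∀ {k} (bs : Vec B k) (g : Vec A k → ℕ) →
  sumOver (allVecs k xs) (λ v → g (zipWith _∙_ v bs)) ≡ sumOver (allVecs k xs) g
sumOver-allVecs-zipWith xs invariant []       g = refl
sumOver-allVecs-zipWith {_∙_ = _∙_} xs invariant {suc k} (b ∷ bs) g = begin
  sumOver (allVecs (suc k) xs) (λ v → g (zipWith _∙_ v (b ∷ bs)))
    ≡⟨ unfold (λ v → g (zipWith _∙_ v (b ∷ bs))) ⟩
  sumOver xs (λ a → sumOver (allVecs k xs) (λ v → g ((a ∙ b) ∷ zipWith _∙_ v bs)))
    ≡⟨ sumOver-cong xs (λ a → sumOver-allVecs-zipWith xs invariant bs (λ v → g ((a ∙ b) ∷ v))) ⟩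
  sumOver xs (λ a → sumOver (allVecs k xs) (λ v → g ((a ∙ b) ∷ v)))
    ≡⟨ invariant b (λ a → sumOver (allVecs k xs) (λ v → g (a ∷ v))) ⟩
  sumOver xs (λ a → sumOver (allVecs k xs) (λ v → g (a ∷ v)))
    ≡⟨ unfold g ⟨
  sumOver (allVecs (suc k) xs) g ∎
  where
  open ≡-Reasoning
  unfold : (h : Vec _ (suc k) → ℕ) →
    sumOver (allVecs (suc k) xs) h ≡ sumOver xs (λ a → sumOver (allVecs k xs) (λ v → h (a ∷ v)))
  unfold h = trans (sumOver-concatMap _ xs h) (sumOver-cong xs (λ a → sumOver-map (a ∷_) (allVecs k xs) h))

sumOver-allAdj-⊕ : (M : Adj n) (g : Adj n → ℕ) → sumOver (allAdj n) (λ A → g (A ⊕ M)) ≡ sumOver (allAdj n) g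
sumOver-allAdj-⊕ {n} M = sumOver-allVecs-zipWith _ (sumOver-allVecs-zipWith _ xor-invariant) M
  where
  xor-invariant : ∀ b (g : Bool → ℕ) → sumOver (true ∷ false ∷ []) (λ a → g (a xor b)) ≡ sumOver (true ∷ false ∷ []) g
  xor-invariant true  g rewrite +-identityʳ (g true) | +-identityʳ (g false) = +-comm (g false) (g true)
  xor-invariant false g = refl

deg-⊕ : (A M : Adj n) (w : Fin n) →
  deg (A ⊕ M) w + ∑[ j < n ] 𝟙 (adj M w j ∧ adj A w j) ≡ deg A w + ∑[ j < n ] 𝟙 (adj M w j ∧ not (adj A w j))
deg-⊕ {n} A M w = begin
  deg (A ⊕ M) w + ∑[ j < n ] 𝟙 (adj M w j ∧ adj A w j)
    ≡⟨ ∑-distrib-+ (λ j → 𝟙 (adj (A ⊕ M) w j)) _ ⟨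
  ∑[ j < n ] (𝟙 (adj (A ⊕ M) w j) + 𝟙 (adj M w j ∧ adj A w j))
    ≡⟨ sum-cong-≗ {n} (λ j → trans (cong (λ b → 𝟙 b + 𝟙 (adj M w j ∧ adj A w j)) (adj-⊕ A M w j)) (𝟙-xor (adj A w j) (adj M w j))) ⟩
  ∑[ j < n ] (𝟙 (adj A w j) + 𝟙 (adj M w j ∧ not (adj A w j)))
    ≡⟨ ∑-distrib-+ (λ j → 𝟙 (adj A w j)) _ ⟩
  deg A w + ∑[ j < n ] 𝟙 (adj M w j ∧ not (adj A w j)) ∎
  where open ≡-Reasoning

-- Counting edges

arcs : Adj n → ℕ
arcs A = ∑∑ (λ i j → 𝟙 (adj A i j))

_<ᶠ_ : Fin n → Fin n → Bool
i <ᶠ j = toℕ i <ᵇ toℕ j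

edgeCount≡∑∑ : (A : Adj n) → edgeCount A ≡ ∑∑ (λ i j → 𝟙 ((i <ᶠ j) ∧ adj A i j))
edgeCount≡∑∑ {n} A =
  trans (length-concatMap _ (allFin n))
  (trans (sumOver-allFin n _) (sum-cong-≗ {n} λ i → trans (length-filterᵇ _ (allFin n)) (sumOver-allFin n _)))

<⇒<ᵇ≡true : ∀ {m n} → m < n → (m <ᵇ n) ≡ true
<⇒<ᵇ≡true = Equivalence.to T-≡ ∘ <⇒<ᵇ

≮⇒<ᵇ≡false : ∀ {m n} → ¬ m < n → (m <ᵇ n) ≡ false
≮⇒<ᵇ≡false {m} {n} m≮n with m <ᵇ n in m<ᵇn
... | true  = ⊥-elim (m≮n (<ᵇ⇒< m n (Equivalence.from T-≡ m<ᵇn)))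
... | false = refl

𝟙-split-by-<ᶠ : (A : Adj n) → IsSimple A → ∀ i j →
  𝟙 (adj A i j) ≡ 𝟙 ((i <ᶠ j) ∧ adj A i j) + 𝟙 ((j <ᶠ i) ∧ adj A i j)
𝟙-split-by-<ᶠ A simple i j with adj A i j in Aij
... | false rewrite ∧-zeroʳ (i <ᶠ j) | ∧-zeroʳ (j <ᶠ i) = refl
... | true rewrite ∧-identityʳ (i <ᶠ j) | ∧-identityʳ (j <ᶠ i) with <-cmp (toℕ i) (toℕ j)
...   | tri< i<j _ j≮i rewrite <⇒<ᵇ≡true i<j | ≮⇒<ᵇ≡false j≮i = refl
...   | tri> i≮j _ j<i rewrite <⇒<ᵇ≡true j<i | ≮⇒<ᵇ≡false i≮j = refl
...   | tri≈ _ i≡j _ with refl ← toℕ-injective i≡j = case trans (sym Aij) (irreflexive simple i) of λ ()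

arcs≡edgeCount+edgeCount : (A : Adj n) → IsSimple A → arcs A ≡ edgeCount A + edgeCount A
arcs≡edgeCount+edgeCount {n} A simple = begin
  arcs A
    ≡⟨ ∑∑-cong (𝟙-split-by-<ᶠ A simple) ⟩
  ∑∑ (λ i j → 𝟙 ((i <ᶠ j) ∧ adj A i j) + 𝟙 ((j <ᶠ i) ∧ adj A i j))
    ≡⟨ ∑∑-distrib-+ {n} _ _ ⟩
  upper + ∑∑ (λ i j → 𝟙 ((j <ᶠ i) ∧ adj A i j))
    ≡⟨ cong (upper +_) (∑-comm (λ i j → 𝟙 ((j <ᶠ i) ∧ adj A i j))) ⟩
  upper + ∑∑ (λ j i → 𝟙 ((j <ᶠ i) ∧ adj A i j))
    ≡⟨ cong (upper +_) (∑∑-cong λ j i → cong (λ b → 𝟙 ((j <ᶠ i) ∧ b)) (symmetric simple i j)) ⟩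
  upper + upper
    ≡⟨ cong₂ _+_ (edgeCount≡∑∑ A) (edgeCount≡∑∑ A) ⟨
  edgeCount A + edgeCount A ∎
  where
  open ≡-Reasoning
  upper : ℕ
  upper = ∑∑ (λ i j → 𝟙 ((i <ᶠ j) ∧ adj A i j))

arcs-positive : (E : Adj n) → IsSimple E → ∀ {m} → edgeCount E ≡ suc m → 0 < arcs E
arcs-positive E simpleE count =
  subst (0 <_) (sym (trans (arcs≡edgeCount+edgeCount E simpleE) (cong₂ _+_ count count))) (s≤s z≤n)

edge-exists : {E : Adj n} → IsSimple E → ∀ {m} → edgeCount E ≡ suc m → ∃[ u ] ∃[ v ] adj E u v ≡ true
edge-exists {E = E} simpleE count
  with u , row-positive ← sum-positive _ (arcs-positive E simpleE count)
  with v , entry-positive ← sum-positive _ row-positive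
  = u , v , 𝟙-positive entry-positive

link : Fin n → Fin n → Fin n → Fin n → Bool
link a b i j = (i =ᵇ a ∧ j =ᵇ b) ∨ (i =ᵇ b ∧ j =ᵇ a)

module _ {a b : Fin n} where

  link-sound : ∀ {i j} → link a b i j ≡ true → (i ≡ a × j ≡ b) ⊎ (i ≡ b × j ≡ a)
  link-sound {i} {j} linked with i ≟ a | j ≟ b | i ≟ b | j ≟ a
  ... | yes i≡a | yes j≡b | _       | _       = inj₁ (i≡a , j≡b)
  ... | yes _   | no _    | yes i≡b | yes j≡a = inj₂ (i≡b , j≡a)
  ... | no _    | _       | yes i≡b | yes j≡a = inj₂ (i≡b , j≡a)

  link-false : ∀ {i j} → ¬ ((i ≡ a × j ≡ b) ⊎ (i ≡ b × j ≡ a)) → link a b i j ≡ false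
  link-false {i} {j} unlinked with link a b i j in linked
  ... | true  = ⊥-elim (unlinked (link-sound linked))
  ... | false = refl

  link-sym : ∀ i j → link a b i j ≡ link a b j i
  link-sym i j rewrite ∧-comm (i =ᵇ a) (j =ᵇ b) | ∧-comm (i =ᵇ b) (j =ᵇ a) = ∨-comm (j =ᵇ b ∧ i =ᵇ a) _

  link-self : link a b a b ≡ true
  link-self rewrite =ᵇ-refl a | =ᵇ-refl b = refl

  link-irreflexive : a ≢ b → ∀ i → link a b i i ≡ false
  link-irreflexive a≢b i = link-false {i} {i} λ { (inj₁ (refl , refl)) → a≢b refl ; (inj₂ (refl , refl)) → a≢b refl }

  sum-link : a ≢ b → ∀ w → ∑[ j < n ] 𝟙 (link a b w j) ≡ 𝟙 (w =ᵇ a) + 𝟙 (w =ᵇ b)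
  sum-link a≢b w = begin
    ∑[ j < n ] 𝟙 (link a b w j)
      ≡⟨ sum-cong-≗ (λ j → trans (𝟙-∨-disjoint _ _ (both j)) (cong₂ _+_ (𝟙-∧ (w =ᵇ a) _) (𝟙-∧ (w =ᵇ b) _))) ⟩
    ∑[ j < n ] (𝟙 (w =ᵇ a) * 𝟙 (j =ᵇ b) + 𝟙 (w =ᵇ b) * 𝟙 (j =ᵇ a))
      ≡⟨ ∑-distrib-+ (λ j → 𝟙 (w =ᵇ a) * 𝟙 (j =ᵇ b)) _ ⟩
    ∑[ j < n ] (𝟙 (w =ᵇ a) * 𝟙 (j =ᵇ b)) + ∑[ j < n ] (𝟙 (w =ᵇ b) * 𝟙 (j =ᵇ a))
      ≡⟨ cong₂ _+_ (*-distribˡ-sum (𝟙 (w =ᵇ a)) (λ j → 𝟙 (j =ᵇ b))) (*-distribˡ-sum (𝟙 (w =ᵇ b)) (λ j → 𝟙 (j =ᵇ a))) ⟨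
    𝟙 (w =ᵇ a) * ∑[ j < n ] 𝟙 (j =ᵇ b) + 𝟙 (w =ᵇ b) * ∑[ j < n ] 𝟙 (j =ᵇ a)
      ≡⟨ cong₂ (λ x y → 𝟙 (w =ᵇ a) * x + 𝟙 (w =ᵇ b) * y) (sum-𝟙-=ᵇ b) (sum-𝟙-=ᵇ a) ⟩
    𝟙 (w =ᵇ a) * 1 + 𝟙 (w =ᵇ b) * 1
      ≡⟨ cong₂ _+_ (*-identityʳ (𝟙 (w =ᵇ a))) (*-identityʳ (𝟙 (w =ᵇ b))) ⟩
    𝟙 (w =ᵇ a) + 𝟙 (w =ᵇ b) ∎
    where
    open ≡-Reasoning
    both : ∀ j → (w =ᵇ a ∧ j =ᵇ b) ≡ true → (w =ᵇ b ∧ j =ᵇ a) ≡ true → ⊥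
    both j wa wb = a≢b (trans (sym (=ᵇ⇒≡ {i = w} (∧-conicalˡ _ (j =ᵇ b) wa))) (=ᵇ⇒≡ {i = w} (∧-conicalˡ _ (j =ᵇ a) wb)))

  ∑∑-link : a ≢ b → ∑∑ (λ i j → 𝟙 (link a b i j)) ≡ 2
  ∑∑-link a≢b =
    trans (sum-cong-≗ (sum-link a≢b))
    (trans (∑-distrib-+ (λ w → 𝟙 (w =ᵇ a)) _) (cong₂ _+_ (sum-𝟙-=ᵇ a) (sum-𝟙-=ᵇ b)))

adj-link : {G : Adj n} → IsSimple G → ∀ {a b i j} → link a b i j ≡ true → adj G i j ≡ adj G a b
adj-link simple {a} {b} {i} {j} linked with link-sound {a = a} {b} {i} {j} linked
... | inj₁ (refl , refl) = refl
... | inj₂ (refl , refl) = symmetric simple _ _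

link-false-by-adj : {H : Adj n} → IsSimple H → ∀ {a b i j} → adj H i j ≡ true → adj H a b ≡ false → link a b i j ≡ false
link-false-by-adj simpleH {a} {b} {i} {j} Hij ¬Hab with link a b i j in linked
... | false = refl
... | true  = case trans (sym Hij) (trans (adj-link simpleH {a} {b} {i} {j} linked) ¬Hab) of λ ()

link-disjoint : {a b c e : Fin n} → a ≢ c → a ≢ e → ∀ {i j} → link a b i j ≡ true → link c e i j ≡ true → ⊥
link-disjoint {a = a} {b} {c} {e} a≢c a≢e {i} {j} ab ce with link-sound {a = a} {b} {i} {j} ab | link-sound {a = c} {e} {i} {j} ce
... | inj₁ (refl , refl) | inj₁ (refl , refl) = a≢c refl
... | inj₁ (refl , refl) | inj₂ (refl , refl) = a≢e refl
... | inj₂ (refl , refl) | inj₁ (refl , refl) = a≢e refl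
... | inj₂ (refl , refl) | inj₂ (refl , refl) = a≢c refl

module DeleteEdge {E : Adj n} (simpleE : IsSimple E) {u v : Fin n} (Euv : adj E u v ≡ true) where

  E⁻ : Adj n
  E⁻ = E ⊕ fromFun (link u v)

  u≢v : u ≢ v
  u≢v refl = case trans (sym Euv) (irreflexive simpleE u) of λ ()

  adj-E⁻ : ∀ i j → adj E⁻ i j ≡ adj E i j xor link u v i j
  adj-E⁻ i j = trans (adj-⊕ E _ i j) (cong (adj E i j xor_) (adj-fromFun (link u v) i j))

  link⊆E : ∀ {i j} → link u v i j ≡ true → adj E i j ≡ true
  link⊆E linked = trans (adj-link simpleE linked) Euv

  E⁻-simple : IsSimple E⁻
  E⁻-simple = record
    { irreflexive = λ i → trans (adj-E⁻ i i) (cong₂ _xor_ (irreflexive simpleE i) (link-irreflexive u≢v i))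
    ; symmetric   = λ i j → trans (adj-E⁻ i j) (trans (cong₂ _xor_ (symmetric simpleE i j) (link-sym i j)) (sym (adj-E⁻ j i)))
    }

  E⁻-sound : ∀ {i j} → adj E⁻ i j ≡ true → adj E i j ≡ true × link u v i j ≡ false
  E⁻-sound {i} {j} E⁻ij with adj E i j in Eij | link u v i j in linked
  ... | true  | false = refl , refl
  ... | true  | true  = case trans (sym E⁻ij) (trans (adj-E⁻ i j) (cong₂ _xor_ Eij linked)) of λ ()
  ... | false | false = case trans (sym E⁻ij) (trans (adj-E⁻ i j) (cong₂ _xor_ Eij linked)) of λ ()
  ... | false | true  = case trans (sym Eij) (link⊆E linked) of λ ()

  arcs-E≡arcs-E⁻+2 : arcs E ≡ arcs E⁻ + 2
  arcs-E≡arcs-E⁻+2 = begin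
    arcs E
      ≡⟨ ∑∑-cong (λ i j → trans (𝟙-xor-⊆ (adj E i j) (link u v i j) link⊆E) (cong (λ b → 𝟙 b + _) (sym (adj-E⁻ i j)))) ⟩
    ∑∑ (λ i j → 𝟙 (adj E⁻ i j) + 𝟙 (link u v i j))
      ≡⟨ ∑∑-distrib-+ (λ i j → 𝟙 (adj E⁻ i j)) _ ⟩
    arcs E⁻ + ∑∑ (λ i j → 𝟙 (link u v i j))
      ≡⟨ cong (arcs E⁻ +_) (∑∑-link u≢v) ⟩
    arcs E⁻ + 2 ∎
    where open ≡-Reasoning

  edgeCount-E⁻ : suc (edgeCount E⁻) ≡ edgeCount E
  edgeCount-E⁻ = double-injective (begin
    suc (edgeCount E⁻) + suc (edgeCount E⁻) ≡⟨ suc+suc (edgeCount E⁻) ⟩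
    edgeCount E⁻ + edgeCount E⁻ + 2        ≡⟨ cong (_+ 2) (arcs≡edgeCount+edgeCount E⁻ E⁻-simple) ⟨
    arcs E⁻ + 2                            ≡⟨ arcs-E≡arcs-E⁻+2 ⟨
    arcs E                                 ≡⟨ arcs≡edgeCount+edgeCount E simpleE ⟩
    edgeCount E + edgeCount E ∎)
    where
    open ≡-Reasoning
    suc+suc : ∀ x → suc x + suc x ≡ x + x + 2
    suc+suc = solve-∀

module _ {d : ℕ} {G : Adj n} (regular : IsRegular d G) where

  arcs-regular : arcs G ≡ n * d
  arcs-regular = trans (sum-cong-≗ (deg≡ regular)) (sum-const n d)

  ∑∑-star : ∀ a → ∑∑ (λ x y → 𝟙 (x =ᵇ a) * 𝟙 (adj G a y)) ≡ 1 * d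
  ∑∑-star a = trans (∑∑-product (λ x → 𝟙 (x =ᵇ a)) (λ y → 𝟙 (adj G a y))) (cong₂ _*_ (sum-𝟙-=ᵇ a) (deg≡ regular a))

  ∑∑-walk : ∀ a → ∑∑ (λ x y → 𝟙 (adj G a x) * 𝟙 (adj G x y)) ≡ d * d
  ∑∑-walk a = begin
    ∑∑ (λ x y → 𝟙 (adj G a x) * 𝟙 (adj G x y))     ≡⟨ sum-cong-≗ {n} (λ x → *-distribˡ-sum (𝟙 (adj G a x)) (λ y → 𝟙 (adj G x y))) ⟨
    ∑[ x < n ] (𝟙 (adj G a x) * deg G x)           ≡⟨ sum-cong-≗ {n} (λ x → cong (𝟙 (adj G a x) *_) (deg≡ regular x)) ⟩
    ∑[ x < n ] (𝟙 (adj G a x) * d)                 ≡⟨ *-distribʳ-sum d (λ x → 𝟙 (adj G a x)) ⟨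
    deg G a * d                                    ≡⟨ cong (_* d) (deg≡ regular a) ⟩
    d * d ∎
    where open ≡-Reasoning

module Switching (d : ℕ) {E : Adj n} (simpleE : IsSimple E) {u v : Fin n} (Euv : adj E u v ≡ true) where

  open DeleteEdge simpleE Euv public

  obstructed : Adj n → Fin n → Fin n → Bool
  obstructed G x y = adj E⁻ x y ∨ (x =ᵇ u) ∨ (y =ᵇ v) ∨ adj G u x ∨ adj G v y

  switchable : Adj n → Fin n → Fin n → Bool
  switchable G x y = adj G x y ∧ not (obstructed G x y)

  -- The 4-cycle u v y x; toggling it removes uv, xy and adds ux, vy.
  cycle : Fin n → Fin n → Fin n → Fin n → Bool
  cycle x y i j = (link u v i j ∨ link x y i j) ∨ (link u x i j ∨ link v y i j)

  switch : Fin n → Fin n → Adj n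
  switch x y = fromFun (cycle x y)

  target : Fin n → Fin n → Adj n → Bool
  target x y G = regularContaining d E⁻ G ∧ (adj G u x ∧ adj G v y)

  module Forward {G : Adj n} (regularG : IsRegular d G) (E⊆G : E ⊆ᴳ G) {x y : Fin n}
                 (sw : switchable G x y ≡ true) where

    private
      simpleG : IsSimple G
      simpleG = simple regularG
      unobstructed : obstructed G x y ≡ false
      unobstructed = not-true (∧-conicalʳ (adj G x y) _ sw)
      unobstructed₁ : ((x =ᵇ u) ∨ (y =ᵇ v) ∨ adj G u x ∨ adj G v y) ≡ false
      unobstructed₁ = ∨-conicalʳ (adj E⁻ x y) _ unobstructed
      unobstructed₂ : ((y =ᵇ v) ∨ adj G u x ∨ adj G v y) ≡ false
      unobstructed₂ = ∨-conicalʳ (x =ᵇ u) _ unobstructed₁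
      unobstructed₃ : (adj G u x ∨ adj G v y) ≡ false
      unobstructed₃ = ∨-conicalʳ (y =ᵇ v) _ unobstructed₂

      Gxy : adj G x y ≡ true
      Gxy = ∧-conicalˡ _ _ sw
      ¬E⁻xy : adj E⁻ x y ≡ false
      ¬E⁻xy = ∨-conicalˡ _ _ unobstructed
      x≢u : x ≢ u
      x≢u = =ᵇ-false⇒≢ (∨-conicalˡ _ _ unobstructed₁)
      y≢v : y ≢ v
      y≢v = =ᵇ-false⇒≢ (∨-conicalˡ _ _ unobstructed₂)
      ¬Gux : adj G u x ≡ false
      ¬Gux = ∨-conicalˡ _ _ unobstructed₃
      ¬Gvy : adj G v y ≡ false
      ¬Gvy = ∨-conicalʳ _ _ unobstructed₃

      Guv : adj G u v ≡ true
      Guv = E⊆G u v Euv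
      x≢y : x ≢ y
      x≢y refl = case trans (sym Gxy) (irreflexive simpleG x) of λ ()
      u≢y : u ≢ y
      u≢y refl = case trans (sym (trans (symmetric simpleG v u) Guv)) ¬Gvy of λ ()

      old-edge : ∀ {i j} → (link u v i j ∨ link x y i j) ≡ true → adj G i j ≡ true
      old-edge linked with ∨-sound linked
      ... | inj₁ uv = trans (adj-link simpleG uv) Guv
      ... | inj₂ xy = trans (adj-link simpleG xy) Gxy

      new-edge : ∀ {i j} → (link u x i j ∨ link v y i j) ≡ true → adj G i j ≡ false
      new-edge linked with ∨-sound linked
      ... | inj₁ ux = trans (adj-link simpleG ux) ¬Gux
      ... | inj₂ vy = trans (adj-link simpleG vy) ¬Gvy

      -- Each of u, v, x, y lies on one removed and one added edge.
      lost≡gained : ∀ w → ∑[ j < n ] 𝟙 (link u v w j ∨ link x y w j) ≡ ∑[ j < n ] 𝟙 (link u x w j ∨ link v y w j)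
      lost≡gained w = begin
        ∑[ j < n ] 𝟙 (link u v w j ∨ link x y w j)
          ≡⟨ sum-𝟙-∨ (link u v w) (link x y w) (λ j → link-disjoint {b = v} (x≢u ∘ sym) u≢y {w} {j}) ⟩
        ∑[ j < n ] 𝟙 (link u v w j) + ∑[ j < n ] 𝟙 (link x y w j)
          ≡⟨ cong₂ _+_ (sum-link u≢v w) (sum-link x≢y w) ⟩
        (𝟙 (w =ᵇ u) + 𝟙 (w =ᵇ v)) + (𝟙 (w =ᵇ x) + 𝟙 (w =ᵇ y))
          ≡⟨ +-interchange (𝟙 (w =ᵇ u)) _ _ _ ⟩
        (𝟙 (w =ᵇ u) + 𝟙 (w =ᵇ x)) + (𝟙 (w =ᵇ v) + 𝟙 (w =ᵇ y))
          ≡⟨ cong₂ _+_ (sum-link (x≢u ∘ sym) w) (sum-link (y≢v ∘ sym) w) ⟨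
        ∑[ j < n ] 𝟙 (link u x w j) + ∑[ j < n ] 𝟙 (link v y w j)
          ≡⟨ sum-𝟙-∨ (link u x w) (link v y w) (λ j → link-disjoint {b = x} u≢v u≢y {w} {j}) ⟨
        ∑[ j < n ] 𝟙 (link u x w j ∨ link v y w j) ∎
        where open ≡-Reasoning

    G′ : Adj n
    G′ = G ⊕ switch x y

    adj-G′ : ∀ i j → adj G′ i j ≡ adj G i j xor cycle x y i j
    adj-G′ i j = trans (adj-⊕ G _ i j) (cong (adj G i j xor_) (adj-fromFun (cycle x y) i j))

    G′-simple : IsSimple G′
    G′-simple = record
      { irreflexive = λ i → trans (adj-G′ i i) (cong₂ _xor_ (irreflexive simpleG i) (cycle-irreflexive i))
      ; symmetric   = λ i j → trans (adj-G′ i j) (trans (cong₂ _xor_ (symmetric simpleG i j) (cycle-sym i j)) (sym (adj-G′ j i)))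
      }
      where
      cycle-irreflexive : ∀ i → cycle x y i i ≡ false
      cycle-irreflexive i
        rewrite link-irreflexive u≢v i | link-irreflexive x≢y i | link-irreflexive (x≢u ∘ sym) i | link-irreflexive (y≢v ∘ sym) i
        = refl
      cycle-sym : ∀ i j → cycle x y i j ≡ cycle x y j i
      cycle-sym i j
        rewrite link-sym {a = u} {v} i j | link-sym {a = x} {y} i j | link-sym {a = u} {x} i j | link-sym {a = v} {y} i j
        = refl

    G′-regular : IsRegular d G′
    G′-regular = record { simple = G′-simple ; deg≡ = λ w → +-cancelʳ-≡ _ _ _ (degree-balance w) }
      where
      degree-balance : ∀ w → deg G′ w + ∑[ j < n ] 𝟙 (link u v w j ∨ link x y w j) ≡ d + ∑[ j < n ] 𝟙 (link u v w j ∨ link x y w j)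
      degree-balance w = begin
        deg G′ w + ∑[ j < n ] 𝟙 (link u v w j ∨ link x y w j)
          ≡⟨ cong (deg G′ w +_) (sum-cong-≗ {n} (λ j → cong 𝟙 (sym (lost j)))) ⟩
        deg G′ w + ∑[ j < n ] 𝟙 (adj (switch x y) w j ∧ adj G w j)
          ≡⟨ deg-⊕ G (switch x y) w ⟩
        deg G w + ∑[ j < n ] 𝟙 (adj (switch x y) w j ∧ not (adj G w j))
          ≡⟨ cong₂ _+_ (deg≡ regularG w) (sum-cong-≗ {n} (λ j → cong 𝟙 (gained j))) ⟩
        d + ∑[ j < n ] 𝟙 (link u x w j ∨ link v y w j)
          ≡⟨ cong (d +_) (lost≡gained w) ⟨
        d + ∑[ j < n ] 𝟙 (link u v w j ∨ link x y w j) ∎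
        where
        open ≡-Reasoning
        lost : ∀ j → (adj (switch x y) w j ∧ adj G w j) ≡ (link u v w j ∨ link x y w j)
        lost j = trans (cong (_∧ adj G w j) (adj-fromFun (cycle x y) w j))
                       (proj₁ (∨-∧-split _ _ (adj G w j) old-edge new-edge))
        gained : ∀ j → (adj (switch x y) w j ∧ not (adj G w j)) ≡ (link u x w j ∨ link v y w j)
        gained j = trans (cong (_∧ not (adj G w j)) (adj-fromFun (cycle x y) w j))
                         (proj₂ (∨-∧-split _ _ (adj G w j) old-edge new-edge))

    E⁻⊆G′ : E⁻ ⊆ᴳ G′
    E⁻⊆G′ i j E⁻ij = trans (adj-G′ i j) (cong₂ _xor_ Gij off-cycle)
      where
      E-and-not-uv : adj E i j ≡ true × link u v i j ≡ false
      E-and-not-uv = E⁻-sound {i} {j} E⁻ij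
      Gij : adj G i j ≡ true
      Gij = E⊆G i j (proj₁ E-and-not-uv)
      off-cycle : cycle x y i j ≡ false
      off-cycle rewrite proj₂ E-and-not-uv
                      | link-false-by-adj E⁻-simple E⁻ij ¬E⁻xy
                      | link-false-by-adj simpleG Gij ¬Gux
                      | link-false-by-adj simpleG Gij ¬Gvy = refl

    G′ux : adj G′ u x ≡ true
    G′ux rewrite adj-G′ u x | ¬Gux | link-self {a = u} {x} | ∨-zeroʳ (link u v u x ∨ link x y u x) = refl

    G′vy : adj G′ v y ≡ true
    G′vy rewrite adj-G′ v y | ¬Gvy | link-self {a = v} {y} | ∨-zeroʳ (link u x v y) | ∨-zeroʳ (link u v v y ∨ link x y v y) = refl

    forward : target x y G′ ≡ true
    forward = cong₂ _∧_ (regularContaining-complete {E = E⁻} G′-regular E⁻⊆G′) (cong₂ _∧_ G′ux G′vy)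

  obstruction-bound : {G : Adj n} → IsRegular d G →
    ∑∑ (λ x y → 𝟙 (adj G x y ∧ obstructed G x y)) ≤ arcs E⁻ + 2 * d * (1 + d)
  obstruction-bound {G} regular = begin
    ∑∑ (λ x y → 𝟙 (adj G x y ∧ obstructed G x y))
      ≤⟨ ∑∑-mono pointwise ⟩
    ∑∑ (λ x y → 𝟙 (adj E⁻ x y) + (𝟙 (x =ᵇ u) * 𝟙 (adj G u y) + (𝟙 (adj G v x) * 𝟙 (y =ᵇ v)
                 + (𝟙 (adj G u x) * 𝟙 (adj G x y) + 𝟙 (adj G v y) * 𝟙 (adj G y x)))))
      ≤⟨ ∑∑-+-≤ {n} ≤-refl (∑∑-+-≤ {n} (≤-reflexive (∑∑-star regular u)) (∑∑-+-≤ {n} (≤-reflexive at-v-sum)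
           (∑∑-+-≤ {n} (≤-reflexive (∑∑-walk regular u)) (≤-reflexive walk-v-sum)))) ⟩
    arcs E⁻ + (1 * d + (d * 1 + (d * d + d * d)))
      ≡⟨ cong (arcs E⁻ +_) (constant d) ⟩
    arcs E⁻ + 2 * d * (1 + d) ∎
    where
    open ≤-Reasoning
    simpleG : IsSimple G
    simpleG = simple regular
    constant : ∀ d → 1 * d + (d * 1 + (d * d + d * d)) ≡ 2 * d * (1 + d)
    constant = solve-∀
    at-v-sum : ∑∑ (λ x y → 𝟙 (adj G v x) * 𝟙 (y =ᵇ v)) ≡ d * 1
    at-v-sum = trans (∑∑-product (λ x → 𝟙 (adj G v x)) (λ y → 𝟙 (y =ᵇ v))) (cong₂ _*_ (deg≡ regular v) (sum-𝟙-=ᵇ v))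
    walk-v-sum : ∑∑ (λ x y → 𝟙 (adj G v y) * 𝟙 (adj G y x)) ≡ d * d
    walk-v-sum = trans (∑-comm (λ x y → 𝟙 (adj G v y) * 𝟙 (adj G y x))) (∑∑-walk regular v)
    pointwise : ∀ x y → 𝟙 (adj G x y ∧ obstructed G x y) ≤
      𝟙 (adj E⁻ x y) + (𝟙 (x =ᵇ u) * 𝟙 (adj G u y) + (𝟙 (adj G v x) * 𝟙 (y =ᵇ v)
        + (𝟙 (adj G u x) * 𝟙 (adj G x y) + 𝟙 (adj G v y) * 𝟙 (adj G y x))))
    pointwise x y =
      ≤-trans (𝟙-∧-∨-≤ g (adj E⁻ x y) _) (+-mono-≤ (𝟙-mono (∧-conicalʳ g (adj E⁻ x y))) (
      ≤-trans (𝟙-∧-∨-≤ g (x =ᵇ u) _) (+-mono-≤ (𝟙-∧-≤ (x =ᵇ u) (adj G u y) at-u) (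
      ≤-trans (𝟙-∧-∨-≤ g (y =ᵇ v) _) (+-mono-≤ (𝟙-∧-≤ (adj G v x) (y =ᵇ v) at-v) (
      ≤-trans (𝟙-∧-∨-≤ g (adj G u x) _) (+-mono-≤ (𝟙-∧-≤ (adj G u x) (adj G x y) walk-u)
                                                  (𝟙-∧-≤ (adj G v y) (adj G y x) walk-v))))))))
      where
      g : Bool
      g = adj G x y
      at-u : adj G x y ≡ true → (x =ᵇ u) ≡ true → ((x =ᵇ u) ∧ adj G u y) ≡ true
      at-u Gxy x=u = cong₂ _∧_ x=u (subst (λ z → adj G z y ≡ true) (=ᵇ⇒≡ x=u) Gxy)
      at-v : adj G x y ≡ true → (y =ᵇ v) ≡ true → (adj G v x ∧ (y =ᵇ v)) ≡ true
      at-v Gxy y=v = cong₂ _∧_ (trans (symmetric simpleG v x) (subst (λ z → adj G x z ≡ true) (=ᵇ⇒≡ y=v) Gxy)) y=v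
      walk-u : adj G x y ≡ true → adj G u x ≡ true → (adj G u x ∧ adj G x y) ≡ true
      walk-u Gxy Gux = cong₂ _∧_ Gux Gxy
      walk-v : adj G x y ≡ true → adj G v y ≡ true → (adj G v y ∧ adj G y x) ≡ true
      walk-v Gxy Gvy = cong₂ _∧_ Gvy (trans (symmetric simpleG y x) Gxy)

  many-switchable : {G : Adj n} → IsRegular d G →
    n * d ≤ ∑∑ (λ x y → 𝟙 (switchable G x y)) + (arcs E⁻ + 2 * d * (1 + d))
  many-switchable {G} regular = begin
    n * d
      ≡⟨ arcs-regular regular ⟨
    ∑∑ (λ x y → 𝟙 (adj G x y))
      ≡⟨ ∑∑-cong (λ x y → 𝟙-split (adj G x y) (obstructed G x y)) ⟩
    ∑∑ (λ x y → 𝟙 (switchable G x y) + 𝟙 (adj G x y ∧ obstructed G x y))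
      ≤⟨ ∑∑-+-≤ {n} ≤-refl (obstruction-bound regular) ⟩
    ∑∑ (λ x y → 𝟙 (switchable G x y)) + (arcs E⁻ + 2 * d * (1 + d)) ∎
    where open ≤-Reasoning

  few-targets : ∀ G → ∑∑ (λ x y → 𝟙 (target x y G)) ≤ 𝟙 (regularContaining d E⁻ G) * (d * d)
  few-targets G with regularContaining d E⁻ G in contains
  ... | false = ≤-reflexive (∑∑-zero n)
  ... | true  = ≤-reflexive (begin
    ∑∑ (λ x y → 𝟙 (adj G u x ∧ adj G v y))      ≡⟨ ∑∑-cong (λ x y → 𝟙-∧ (adj G u x) (adj G v y)) ⟩
    ∑∑ (λ x y → 𝟙 (adj G u x) * 𝟙 (adj G v y))  ≡⟨ ∑∑-product (λ x → 𝟙 (adj G u x)) (λ y → 𝟙 (adj G v y)) ⟩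
    deg G u * deg G v                           ≡⟨ cong₂ _*_ (deg≡ regular u) (deg≡ regular v) ⟩
    d * d                                       ≡⟨ +-identityʳ (d * d) ⟨
    1 * (d * d) ∎)
    where
    open ≡-Reasoning
    regular : IsRegular d G
    regular = proj₁ (regularContaining-sound {E = E⁻} contains)

  -- For fixed x y the switching G ↦ G ⊕ switch x y is an involution of all matrices,
  -- so summing over its images counts every target graph once.
  switched-count :
    sumOver (allAdj n) (λ G → 𝟙 (regularContaining d E G) * ∑∑ (λ x y → 𝟙 (switchable G x y)))
      ≤ #regularContaining d E⁻ * (d * d)
  switched-count = begin
    ΣG (λ G → 𝟙 (inA G) * ∑∑ (λ x y → 𝟙 (switchable G x y)))
      ≡⟨ sumOver-cong (allAdj n) (λ G → trans (∑∑-*ˡ (𝟙 (inA G)) (λ x y → 𝟙 (switchable G x y))) (∑∑-cong {n} (λ x y → sym (𝟙-∧ (inA G) _)))) ⟩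
    ΣG (λ G → ∑∑ (λ x y → 𝟙 (inA G ∧ switchable G x y)))
      ≡⟨ sumOver-∑∑-comm (allAdj n) (λ G x y → 𝟙 (inA G ∧ switchable G x y)) ⟩
    ∑∑ (λ x y → ΣG (λ G → 𝟙 (inA G ∧ switchable G x y)))
      ≤⟨ ∑∑-mono {n} (λ x y → sumOver-mono (allAdj n) (λ G → 𝟙-mono (switching-hits-target x y G))) ⟩
    ∑∑ (λ x y → ΣG (λ G → 𝟙 (target x y (G ⊕ switch x y))))
      ≡⟨ ∑∑-cong {n} (λ x y → sumOver-allAdj-⊕ (switch x y) (𝟙 ∘ target x y)) ⟩
    ∑∑ (λ x y → ΣG (λ G → 𝟙 (target x y G)))
      ≡⟨ sumOver-∑∑-comm (allAdj n) (λ G x y → 𝟙 (target x y G)) ⟨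
    ΣG (λ G → ∑∑ (λ x y → 𝟙 (target x y G)))
      ≤⟨ sumOver-mono (allAdj n) few-targets ⟩
    ΣG (λ G → 𝟙 (regularContaining d E⁻ G) * (d * d))
      ≡⟨ sumOver-*ʳ (allAdj n) (d * d) _ ⟩
    #regularContaining d E⁻ * (d * d) ∎
    where
    open ≤-Reasoning
    ΣG : (Adj n → ℕ) → ℕ
    ΣG = sumOver (allAdj n)
    inA : Adj n → Bool
    inA = regularContaining d E
    switching-hits-target : ∀ x y G → (inA G ∧ switchable G x y) ≡ true → target x y (G ⊕ switch x y) ≡ true
    switching-hits-target x y G both = Forward.forward (proj₁ G-good) (proj₂ G-good) (∧-conicalʳ (inA G) (switchable G x y) both)
      where
      G-good : IsRegular d G × E ⊆ᴳ G
      G-good = regularContaining-sound {E = E} (∧-conicalˡ (inA G) (switchable G x y) both)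

  switching-inequality :
    #regularContaining d E * (n * d)
      ≤ #regularContaining d E⁻ * (d * d) + #regularContaining d E * (arcs E⁻ + 2 * d * (1 + d))
  switching-inequality = begin
    #regularContaining d E * (n * d)
      ≡⟨ sumOver-*ʳ (allAdj n) (n * d) (𝟙 ∘ inA) ⟨
    ΣG (λ G → 𝟙 (inA G) * (n * d))
      ≤⟨ sumOver-mono (allAdj n) per-graph ⟩
    ΣG (λ G → 𝟙 (inA G) * ∑∑ (λ x y → 𝟙 (switchable G x y)) + 𝟙 (inA G) * K)
      ≡⟨ sumOver-distrib-+ (allAdj n) (λ G → 𝟙 (inA G) * ∑∑ (λ x y → 𝟙 (switchable G x y))) _ ⟩
    ΣG (λ G → 𝟙 (inA G) * ∑∑ (λ x y → 𝟙 (switchable G x y))) + ΣG (λ G → 𝟙 (inA G) * K)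
      ≤⟨ +-mono-≤ switched-count (≤-reflexive (sumOver-*ʳ (allAdj n) K (𝟙 ∘ inA))) ⟩
    #regularContaining d E⁻ * (d * d) + #regularContaining d E * K ∎
    where
    open ≤-Reasoning
    ΣG : (Adj n → ℕ) → ℕ
    ΣG = sumOver (allAdj n)
    inA : Adj n → Bool
    inA = regularContaining d E
    K : ℕ
    K = arcs E⁻ + 2 * d * (1 + d)
    per-graph : ∀ G → 𝟙 (inA G) * (n * d) ≤ 𝟙 (inA G) * ∑∑ (λ x y → 𝟙 (switchable G x y)) + 𝟙 (inA G) * K
    per-graph G with inA G in contains
    ... | false = z≤n
    ... | true  = ≤-trans (*-monoʳ-≤ 1 (many-switchable {G} (proj₁ (regularContaining-sound {E = E} contains))))
                          (≤-reflexive (*-distribˡ-+ 1 (∑∑ (λ x y → 𝟙 (switchable G x y))) K))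

-- Induction on the number of edges

-- The obstructed pairs cost 2m + 2d(1 + d); sparsity absorbs the 2m, and half of
-- p n d absorbs 2d(1 + d) once n ≥ 4q(1 + d).
switching-arithmetic : ∀ {a b n d p q m} .{{_ : NonZero p}} .{{_ : NonZero d}} →
  a * (n * d) ≤ b * (d * d) + a * ((m + m) + 2 * d * (1 + d)) →
  2 * suc m * q + p * n * d ≤ q * n * d →
  4 * q * (1 + d) ≤ n →
  a * n ≤ 2 * q * d * b
switching-arithmetic {a} {b} {n} {d} {p} {q} {m} switching density n≥N =
  *-cancelˡ-≤ d (begin
    d * (a * n)            ≡⟨ *-assoc d a n ⟨
    d * a * n              ≡⟨ cong (_* n) (*-comm d a) ⟩
    a * d * n              ≤⟨ adn≤X ⟩
    X                      ≤⟨ X≤2qbd² ⟩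
    2 * (q * b * (d * d))  ≡⟨ regroup q b d ⟩
    d * (2 * q * d * b)    ∎)
  where
  open ≤-Reasoning
  K X Y : ℕ
  K = 2 * d * (1 + d)
  X = a * d * n * p
  Y = a * q * (n * d) + a * q * (m + m)
  regroup : ∀ q b d → 2 * (q * b * (d * d)) ≡ d * (2 * q * d * b)
  regroup = solve-∀
  adn≤X : a * d * n ≤ X
  adn≤X = m≤m*n (a * d * n) p
  X≤qbd²+aqK : X ≤ q * b * (d * d) + a * q * K
  X≤qbd²+aqK = ≤-trans (m≤m+n X (2 * a * q)) (+-cancelˡ-≤ Y _ _ (begin
    Y + (X + 2 * a * q)
      ≡⟨ expand-left a q n d m p ⟩
    q * (a * (n * d)) + a * (2 * suc m * q + p * n * d)
      ≤⟨ +-mono-≤ (*-monoʳ-≤ q switching) (*-monoʳ-≤ a density) ⟩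
    q * (b * (d * d) + a * ((m + m) + K)) + a * (q * n * d)
      ≡⟨ expand-right a b q n d m K ⟩
    Y + (q * b * (d * d) + a * q * K) ∎))
    where
    expand-left : ∀ a q n d m p → a * q * (n * d) + a * q * (m + m) + (a * d * n * p + 2 * a * q)
                    ≡ q * (a * (n * d)) + a * (2 * (1 + m) * q + p * n * d)
    expand-left = solve-∀
    expand-right : ∀ a b q n d m k → q * (b * (d * d) + a * ((m + m) + k)) + a * (q * n * d)
                    ≡ a * q * (n * d) + a * q * (m + m) + (q * b * (d * d) + a * q * k)
    expand-right = solve-∀
  2aqK≤X : 2 * (a * q * K) ≤ X
  2aqK≤X = begin
    2 * (a * q * K)            ≡⟨ regroup′ a q d ⟩
    a * d * (4 * q * (1 + d))  ≤⟨ *-monoʳ-≤ (a * d) n≥N ⟩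
    a * d * n                  ≤⟨ adn≤X ⟩
    X                          ∎
    where
    regroup′ : ∀ a q d → 2 * (a * q * (2 * d * (1 + d))) ≡ a * d * (4 * q * (1 + d))
    regroup′ = solve-∀
  X≤2qbd² : X ≤ 2 * (q * b * (d * d))
  X≤2qbd² = +-cancelˡ-≤ X _ _ (begin
    X + X                                    ≡⟨ cong (X +_) (+-identityʳ X) ⟨
    2 * X                                    ≤⟨ *-monoʳ-≤ 2 X≤qbd²+aqK ⟩
    2 * (q * b * (d * d) + a * q * K)        ≡⟨ *-distribˡ-+ 2 (q * b * (d * d)) _ ⟩
    2 * (q * b * (d * d)) + 2 * (a * q * K)  ≤⟨ +-monoʳ-≤ (2 * (q * b * (d * d))) 2aqK≤X ⟩
    2 * (q * b * (d * d)) + X                ≡⟨ +-comm _ X ⟩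
    X + 2 * (q * b * (d * d))                ∎)

module _ {p q d n : ℕ} .{{_ : NonZero p}} .{{_ : NonZero d}} (n≥N : 4 * q * (1 + d) ≤ n) where

  -- |E| ≤ (1 − ε) nd/2 with ε = p/q.
  Sparse : Adj n → Set
  Sparse E = 2 * edgeCount E * q + p * n * d ≤ q * n * d

  deletion-step : {E : Adj n} (simpleE : IsSimple E) {u v : Fin n} (Euv : adj E u v ≡ true) → Sparse E →
    #regularContaining d E * n ≤ 2 * q * d * #regularContaining d (DeleteEdge.E⁻ simpleE Euv)
  deletion-step {E} simpleE Euv sparse =
    switching-arithmetic {#E} {#E⁻} {n} {d} {p} {q} {edgeCount E⁻} switching density n≥N
    where
    open Switching d simpleE Euv
    #E #E⁻ : ℕ
    #E  = #regularContaining d E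
    #E⁻ = #regularContaining d E⁻
    switching : #E * (n * d) ≤ #E⁻ * (d * d) + #E * ((edgeCount E⁻ + edgeCount E⁻) + 2 * d * (1 + d))
    switching = subst (λ k → #E * (n * d) ≤ #E⁻ * (d * d) + #E * (k + 2 * d * (1 + d)))
                      (arcs≡edgeCount+edgeCount E⁻ E⁻-simple) switching-inequality
    density : 2 * suc (edgeCount E⁻) * q + p * n * d ≤ q * n * d
    density = subst (λ k → 2 * k * q + p * n * d ≤ q * n * d) (sym edgeCount-E⁻) sparse

  regular-count-bound : ∀ m (E : Adj n) → IsSimple E → edgeCount E ≡ m → Sparse E →
    #regularContaining d E * n ^ m ≤ (2 * q * d) ^ m * numRegular n d
  regular-count-bound zero E _ _ _ = begin
    #regularContaining d E * 1  ≡⟨ *-identityʳ _ ⟩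
    #regularContaining d E      ≤⟨ #regularContaining≤numRegular d E ⟩
    numRegular n d              ≡⟨ *-identityˡ _ ⟨
    1 * numRegular n d          ∎
    where open ≤-Reasoning
  regular-count-bound (suc m) E simpleE count sparse with u , v , Euv ← edge-exists simpleE count = begin
    #regularContaining d E * (n * n ^ m)         ≡⟨ *-assoc (#regularContaining d E) n (n ^ m) ⟨
    #regularContaining d E * n * n ^ m           ≤⟨ *-monoˡ-≤ (n ^ m) (deletion-step simpleE Euv sparse) ⟩
    C * #regularContaining d E⁻ * n ^ m          ≡⟨ *-assoc C _ (n ^ m) ⟩
    C * (#regularContaining d E⁻ * n ^ m)        ≤⟨ *-monoʳ-≤ C (regular-count-bound m E⁻ E⁻-simple count⁻ sparse⁻) ⟩
    C * (C ^ m * numRegular n d)                 ≡⟨ *-assoc C (C ^ m) _ ⟨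
    C * C ^ m * numRegular n d                   ∎
    where
    open ≤-Reasoning
    open DeleteEdge simpleE Euv
    C : ℕ
    C = 2 * q * d
    count⁻ : edgeCount E⁻ ≡ m
    count⁻ = suc-injective (trans edgeCount-E⁻ count)
    sparse⁻ : Sparse E⁻
    sparse⁻ = ≤-trans (+-monoˡ-≤ (p * n * d) (*-monoˡ-≤ q (*-monoʳ-≤ 2 (≤-trans (n≤1+n _) (≤-reflexive edgeCount-E⁻))))) sparse

corollary2p15 : (p q : ℕ) → 0 < p → 0 < q → (d : ℕ) → 3 ≤ d →
    ∃[ C ] ∃[ N ] ((n : ℕ) → n ≥ N → 2 ∣ d * n →
      (E₀ : Adj n) → T (isSimpleGraph E₀) →
      2 * edgeCount E₀ * q + p * n * d ≤ q * n * d →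
      numRegularContaining n d E₀ * n ^ edgeCount E₀
        ≤ (C * d) ^ edgeCount E₀ * numRegular n d)
corollary2p15 p q p>0 _ d d≥3 = 2 * q , 4 * q * (1 + d) , λ n n≥N _ E₀ simple sparse →
  subst (λ c → c * n ^ edgeCount E₀ ≤ (2 * q * d) ^ edgeCount E₀ * numRegular n d) (sym (numRegularContaining≡ n d E₀))
    (regular-count-bound {{>-nonZero p>0}} {{>-nonZero (≤-trans (s≤s z≤n) d≥3)}} n≥N
      (edgeCount E₀) E₀ (isSimpleGraph-sound E₀ (Equivalence.to T-≡ simple)) refl sparse)
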